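{- For every integer $k\ge0$, as formal power series in $x$ with coefficients in $\mathbb{Z}[s,t]$, $$\frac{1}{\sum_{j=0}^{k+1}(-1)^{\binom{j+1}{2}}t^{\binom{j}{2}}\binom{k+1}{j}_{F(s,t)}x^j}=\sum_{n\ge0}\binom{n+k}{k}_{F(s,t)}x^n.$$
   Context: $s,t$ are indeterminates. The Fibonacci polynomials are defined by $F_0(s,t)=0$, $F_1(s,t)=1$, $F_n(s,t)=sF_{n-1}(s,t)+tF_{n-2}(s,t)$. The Fibonomials are $\binom{n}{k}_{F(s,t)}=\prod_{j=0}^{k-1}\frac{F_{n-j}(s,t)}{F_{k-j}(s,t)}$ for $0\le k\le n$ (these are polynomials in $s,t$). -}

module Defs where

open import Data.Nat as ℕ using (ℕ; zero; suc; _∸_; _≤?_)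
open import Data.Nat.Combinatorics using (_C_)
open import Data.Integer as ℤ using (ℤ)
open import Data.List using (List; []; _∷_; map)
open import Data.Product using (_×_; _,_; proj₁; proj₂)
open import Relation.Nullary using (yes; no)
open import Relation.Binary.PropositionalEquality using (_≡_)


-- Dense univariate polynomials (coefficient lists, lowest degree first)
-- over a ring given by its raw operations.

module Poly {A : Set} (0# 1# : A) (_+_ _*_ : A → A → A) (-_ : A → A) where

  Pol : Set
  Pol = List A

  _⊕_ : Pol → Pol → Pol
  []      ⊕ q       = q
  (a ∷ p) ⊕ []      = a ∷ p
  (a ∷ p) ⊕ (b ∷ q) = (a + b) ∷ (p ⊕ q)

  _⊗_ : Pol → Pol → Pol
  []      ⊗ q = []
  (a ∷ p) ⊗ q = map (a *_) q ⊕ (0# ∷ (p ⊗ q))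

  neg : Pol → Pol
  neg = map -_

  const : A → Pol
  const a = a ∷ []

  X : Pol
  X = 0# ∷ 1# ∷ []

  coeff : Pol → ℕ → A
  coeff []      _       = 0#
  coeff (a ∷ p) zero    = a
  coeff (a ∷ p) (suc i) = coeff p i

module PT = Poly (ℤ.+ 0) (ℤ.+ 1) ℤ._+_ ℤ._*_ ℤ.-_

-- ℤ[s,t] = (ℤ[t])[s]
module PST = Poly ([] {A = ℤ}) (PT.const (ℤ.+ 1)) PT._⊕_ PT._⊗_ PT.neg

ℤ[s,t] : Set
ℤ[s,t] = PST.Pol

infixl 6 _+P_
infixl 7 _*P_
_+P_ _*P_ : ℤ[s,t] → ℤ[s,t] → ℤ[s,t]
_+P_ = PST._⊕_
_*P_ = PST._⊗_

-P_ : ℤ[s,t] → ℤ[s,t]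
-P_ = PST.neg

0P 1P : ℤ[s,t]
0P = []
1P = PST.const (PT.const (ℤ.+ 1))

s t : ℤ[s,t]
s = PST.X
t = PST.const PT.X

coeffST : ℤ[s,t] → ℕ → ℕ → ℤ
coeffST p i j = PT.coeff (PST.coeff p i) j

infix 4 _≈P_
_≈P_ : ℤ[s,t] → ℤ[s,t] → Set
p ≈P q = ∀ i j → coeffST p i j ≡ coeffST q i j

_^P_ : ℤ[s,t] → ℕ → ℤ[s,t]
p ^P zero  = 1P
p ^P suc n = p *P (p ^P n)

sgn : ℕ → ℤ[s,t]
sgn zero    = 1P
sgn (suc m) = -P (sgn m)

F : ℕ → ℤ[s,t]
F zero          = 0P
F (suc zero)    = 1P
F (suc (suc n)) = s *P F (suc n) +P t *P F n

prodF : ℕ → ℕ → ℤ[s,t]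
prodF n zero    = 1P
prodF n (suc k) = F (n ∸ k) *P prodF n k

-- Fractions over ℤ[s,t] (the field of fractions, as a setoid), used to
-- state the Fibonomial literally as the quotient in its definition.

Frac : Set
Frac = ℤ[s,t] × ℤ[s,t]

infix 4 _≃_
_≃_ : Frac → Frac → Set
(a , b) ≃ (c , d) = a *P d ≈P c *P b

infixl 6 _+F_
infixl 7 _*F_
_+F_ _*F_ : Frac → Frac → Frac
(a , b) +F (c , d) = (a *P d +P c *P b , b *P d)
(a , b) *F (c , d) = (a *P c , b *P d)

ι : ℤ[s,t] → Frac
ι p = (p , 1P)

-- Fibonomial  binom(n,k)_F = ∏_{j=0}^{k-1} F_{n-j} / F_{k-j}   (used for k ≤ n)
fibonomial : ℕ → ℕ → Frac
fibonomial n k = (prodF n k , prodF k k)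

sumTo : ℕ → (ℕ → Frac) → Frac
sumTo zero    f = f zero
sumTo (suc n) f = sumTo n f +F f (suc n)

denomCoeff : ℕ → ℕ → Frac
denomCoeff k j with j ≤? suc k
... | yes _ = ι (sgn (suc j C 2) *P (t ^P (j C 2))) *F fibonomial (suc k) j
... | no  _ = ι 0P

seriesCoeff : ℕ → ℕ → Frac
seriesCoeff k n = fibonomial (n ℕ.+ k) k

cauchy : (ℕ → Frac) → (ℕ → Frac) → ℕ → Frac
cauchy a b n = sumTo n (λ j → a j *F b (n ∸ j))

oneSeries : ℕ → Frac
oneSeries zero    = ι 1P
oneSeries (suc n) = ι 0P

module Submission where

-- Let α, β be the roots of x² = s x + t, so that F n = (αⁿ - βⁿ) / (α - β) and α β = -t.  The
-- denominator is then D_k(x) = ∏_{i ≤ k} (1 - αᵏ⁻ⁱ βⁱ x), and the claim is that it is inverted by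
-- G_k(x) = ∑ {n + k choose k} xⁿ.  Staying inside ℤ[s,t], we argue by induction from k to k + 2:
-- with Q_k(x) = (1 - αᵏ⁺² x) (1 - βᵏ⁺² x) = 1 - L_{k+2} x + (-t)ᵏ⁺² x², the Fibonomial
-- three-term recurrence gives D_{k+2}(x) = Q_k(x) D_k(-t x) and Q_k(x) G_{k+2}(x) = G_k(-t x),
-- so D_{k+2} G_{k+2} = D_k(-t x) G_k(-t x) = 1.  Every Fibonomial fraction of the statement is
-- identified with the polynomial given by a Pascal-type recurrence.

open import Algebra using (CommutativeRing)
open import Algebra.Structures using (IsCommutativeRing)
open import Algebra.Solver.Ring.AlmostCommutativeRing using (fromCommutativeRing; _-Raw-AlmostCommutative⟶_)
import Algebra.Solver.Ring
open import Data.Integer as ℤ using (ℤ; +_; -[1+_]; _⊖_; _◃_; ∣_∣; sign)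
open import Data.Integer.Properties using (+-*-commutativeRing; [1+m]⊖[1+n]≡m⊖n; ◃-inverse)
open import Data.List using ([]; _∷_; map)
open import Data.Maybe as Maybe using (Maybe)
open import Data.Nat as ℕ using (ℕ; zero; suc; _∸_; _≤_; _<_; z≤n; s≤s)
import Data.Nat.Properties as ℕₚ
open import Data.Nat.Combinatorics using (_C_; nCk+nC[k+1]≡[n+1]C[k+1]; nC1≡n)
open import Data.Product using (_,_; proj₁; proj₂)
open import Data.Sign as Sign using (Sign)
open import Data.Sum using (inj₁; inj₂)
open import Level using (0ℓ)
open import Relation.Binary.Consequences using (dec⇒weaklyDec)
open import Relation.Binary.Structures using (IsEquivalence)
import Relation.Binary.PropositionalEquality as ≡
open import Relation.Nullary using (yes; no)
open import Defs using (module Poly)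

-- The ring solver over an arbitrary commutative ring, with integer coefficients interpreted through
-- the canonical map ℤ → R (the library's natural-number coefficients cannot express negation).
-- The optimised _×_ makes ⟦ + 1 ⟧ℤ reduce to 1#, so solved equations may mention 1# literally.
module ℤ-Solver {c ℓ} (R : CommutativeRing c ℓ) where

  open CommutativeRing R
  open import Algebra.Properties.Semiring.Mult.TCOptimised semiring using (_×_; ×-homo-+; ×1-homo-*)
  open import Algebra.Properties.Ring ring using (-0#≈0#; -‿+-comm; -‿involutive; -1*x≈-x)
  open import Algebra.Properties.CommutativeSemigroup +-commutativeSemigroup
    using () renaming (interchange to +-interchange)
  open import Algebra.Properties.CommutativeSemigroup *-commutativeSemigroup
    using () renaming (interchange to *-interchange)
  open import Relation.Binary.Reasoning.Setoid setoid

  ⟦_⟧ℤ : ℤ → Carrier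
  ⟦ + n ⟧ℤ      = n × 1#
  ⟦ -[1+ n ] ⟧ℤ = - (suc n × 1#)

  ⊖-homo : ∀ m n → ⟦ m ⊖ n ⟧ℤ ≈ m × 1# - n × 1#
  ⊖-homo zero    zero    = sym (trans (+-congˡ -0#≈0#) (+-identityʳ 0#))
  ⊖-homo (suc m) zero    = sym (trans (+-congˡ -0#≈0#) (+-identityʳ _))
  ⊖-homo zero    (suc n) = sym (+-identityˡ _)
  ⊖-homo (suc m) (suc n) = begin
    ⟦ suc m ⊖ suc n ⟧ℤ                  ≡⟨ ≡.cong ⟦_⟧ℤ ([1+m]⊖[1+n]≡m⊖n m n) ⟩
    ⟦ m ⊖ n ⟧ℤ                          ≈⟨ ⊖-homo m n ⟩
    m × 1# - n × 1#                     ≈⟨ +-identityˡ _ ⟨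
    0# + (m × 1# - n × 1#)              ≈⟨ +-congʳ (-‿inverseʳ 1#) ⟨
    (1# - 1#) + (m × 1# - n × 1#)       ≈⟨ +-interchange 1# (- 1#) _ _ ⟩
    (1# + m × 1#) + (- 1# - n × 1#)     ≈⟨ +-congˡ (-‿+-comm 1# (n × 1#)) ⟩
    (1# + m × 1#) - (1# + n × 1#)       ≈⟨ +-cong (×-homo-+ 1# 1 m) (-‿cong (×-homo-+ 1# 1 n)) ⟨
    suc m × 1# - suc n × 1#             ∎

  +-homo : ∀ i j → ⟦ i ℤ.+ j ⟧ℤ ≈ ⟦ i ⟧ℤ + ⟦ j ⟧ℤ
  +-homo (+ m)    (+ n)    = ×-homo-+ 1# m n
  +-homo (+ m)    -[1+ n ] = ⊖-homo m (suc n)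
  +-homo -[1+ m ] (+ n)    = trans (⊖-homo n (suc m)) (+-comm _ _)
  +-homo -[1+ m ] -[1+ n ] = begin
    - (suc (suc (m ℕ.+ n)) × 1#)        ≡⟨ ≡.cong (λ k → - (suc k × 1#)) (ℕₚ.+-suc m n) ⟨
    - ((suc m ℕ.+ suc n) × 1#)          ≈⟨ -‿cong (×-homo-+ 1# (suc m) (suc n)) ⟩
    - (suc m × 1# + suc n × 1#)         ≈⟨ -‿+-comm _ _ ⟨
    - (suc m × 1#) - (suc n × 1#)       ∎

  -‿homo : ∀ i → ⟦ ℤ.- i ⟧ℤ ≈ - ⟦ i ⟧ℤ
  -‿homo (+ zero)  = sym -0#≈0#
  -‿homo (+ suc n) = refl
  -‿homo -[1+ n ]  = sym (-‿involutive _)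

  ⟦_⟧± : Sign → Carrier
  ⟦ Sign.+ ⟧± = 1#
  ⟦ Sign.- ⟧± = - 1#

  sign-homo : ∀ σ τ → ⟦ σ Sign.* τ ⟧± ≈ ⟦ σ ⟧± * ⟦ τ ⟧±
  sign-homo Sign.+ τ      = sym (*-identityˡ _)
  sign-homo Sign.- Sign.+ = sym (*-identityʳ _)
  sign-homo Sign.- Sign.- = begin
    1#              ≈⟨ -‿involutive 1# ⟨
    - - 1#          ≈⟨ -1*x≈-x (- 1#) ⟨
    - 1# * - 1#     ∎

  ◃-homo : ∀ σ n → ⟦ σ ◃ n ⟧ℤ ≈ ⟦ σ ⟧± * (n × 1#)
  ◃-homo σ      zero    = sym (zeroʳ _)
  ◃-homo Sign.+ (suc n) = sym (*-identityˡ _)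
  ◃-homo Sign.- (suc n) = sym (-1*x≈-x _)

  sign-abs-homo : ∀ i → ⟦ i ⟧ℤ ≈ ⟦ sign i ⟧± * (∣ i ∣ × 1#)
  sign-abs-homo i = begin
    ⟦ i ⟧ℤ                           ≡⟨ ≡.cong ⟦_⟧ℤ (◃-inverse i) ⟨
    ⟦ sign i ◃ ∣ i ∣ ⟧ℤ              ≈⟨ ◃-homo (sign i) ∣ i ∣ ⟩
    ⟦ sign i ⟧± * (∣ i ∣ × 1#)       ∎

  *-homo : ∀ i j → ⟦ i ℤ.* j ⟧ℤ ≈ ⟦ i ⟧ℤ * ⟦ j ⟧ℤ
  *-homo i j = begin
    ⟦ sign i Sign.* sign j ◃ ∣ i ∣ ℕ.* ∣ j ∣ ⟧ℤ
      ≈⟨ ◃-homo (sign i Sign.* sign j) (∣ i ∣ ℕ.* ∣ j ∣) ⟩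
    ⟦ sign i Sign.* sign j ⟧± * ((∣ i ∣ ℕ.* ∣ j ∣) × 1#)
      ≈⟨ *-cong (sign-homo (sign i) (sign j)) (×1-homo-* ∣ i ∣ ∣ j ∣) ⟩
    (⟦ sign i ⟧± * ⟦ sign j ⟧±) * ((∣ i ∣ × 1#) * (∣ j ∣ × 1#))
      ≈⟨ *-interchange _ _ _ _ ⟩
    (⟦ sign i ⟧± * (∣ i ∣ × 1#)) * (⟦ sign j ⟧± * (∣ j ∣ × 1#))
      ≈⟨ *-cong (sign-abs-homo i) (sign-abs-homo j) ⟨
    ⟦ i ⟧ℤ * ⟦ j ⟧ℤ ∎

  homomorphism : CommutativeRing.rawRing +-*-commutativeRing
                   -Raw-AlmostCommutative⟶ fromCommutativeRing R
  homomorphism = record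
    { ⟦_⟧    = ⟦_⟧ℤ
    ; +-homo = +-homo
    ; *-homo = *-homo
    ; -‿homo = -‿homo
    ; 0-homo = refl
    ; 1-homo = refl
    }

  ≟-homo : ∀ i j → Maybe (⟦ i ⟧ℤ ≈ ⟦ j ⟧ℤ)
  ≟-homo i j = Maybe.map (λ { ≡.refl → refl }) (dec⇒weaklyDec ℤ._≟_ i j)

  open Algebra.Solver.Ring _ _ homomorphism ≟-homo public

  :0 :1 : ∀ {n} → Polynomial n
  :0 = con (+ 0)
  :1 = con (+ 1)

-- Coefficient lists over R, compared coefficientwise (so trailing zeros do not matter), form a
-- commutative ring.  _≋_ is a record so that both polynomials can be inferred from a proof.
module PolynomialRing {ℓ} (R : CommutativeRing 0ℓ ℓ) where

  open CommutativeRing R hiding (zero)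
  open import Algebra.Properties.Ring ring using (-0#≈0#)
  open import Algebra.Properties.CommutativeSemigroup +-commutativeSemigroup
    using () renaming (interchange to +-interchange; x∙yz≈y∙xz to +-leftComm)
  open Poly 0# 1# _+_ _*_ -_
  open import Relation.Binary.Reasoning.Setoid setoid

  infix 4 _≋_
  record _≋_ (p q : Pol) : Set ℓ where
    constructor coeffwise
    field coeff-≈ : ∀ i → coeff p i ≈ coeff q i
  open _≋_

  ≋-isEquivalence : IsEquivalence _≋_
  ≋-isEquivalence = record
    { refl  = coeffwise λ _ → refl
    ; sym   = λ e → coeffwise λ i → sym (coeff-≈ e i)
    ; trans = λ e f → coeffwise λ i → trans (coeff-≈ e i) (coeff-≈ f i)
    }
  open IsEquivalence ≋-isEquivalence using () renaming (refl to ≋-refl; sym to ≋-sym; trans to ≋-trans)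

  scale : Carrier → Pol → Pol
  scale a = map (a *_)

  coeff-⊕ : ∀ p q i → coeff (p ⊕ q) i ≈ coeff p i + coeff q i
  coeff-⊕ []      q       i       = sym (+-identityˡ _)
  coeff-⊕ (a ∷ p) []      i       = sym (+-identityʳ _)
  coeff-⊕ (a ∷ p) (b ∷ q) zero    = refl
  coeff-⊕ (a ∷ p) (b ∷ q) (suc i) = coeff-⊕ p q i

  coeff-scale : ∀ a q i → coeff (scale a q) i ≈ a * coeff q i
  coeff-scale a []      i       = sym (zeroʳ a)
  coeff-scale a (b ∷ q) zero    = refl
  coeff-scale a (b ∷ q) (suc i) = coeff-scale a q i

  coeff-neg : ∀ p i → coeff (neg p) i ≈ - coeff p i
  coeff-neg []      i       = sym -0#≈0#
  coeff-neg (a ∷ p) zero    = refl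
  coeff-neg (a ∷ p) (suc i) = coeff-neg p i

  coeff-∷⊗ : ∀ a p q i → coeff ((a ∷ p) ⊗ q) i ≈ a * coeff q i + coeff (0# ∷ (p ⊗ q)) i
  coeff-∷⊗ a p q i = trans (coeff-⊕ (scale a q) _ i) (+-congʳ (coeff-scale a q i))

  ∷-cong : ∀ {a b p q} → a ≈ b → p ≋ q → (a ∷ p) ≋ (b ∷ q)
  ∷-cong a≈b p≋q = coeffwise λ { zero → a≈b ; (suc i) → coeff-≈ p≋q i }

  ⊕-cong : ∀ {p p′ q q′} → p ≋ p′ → q ≋ q′ → (p ⊕ q) ≋ (p′ ⊕ q′)
  ⊕-cong {p} {p′} {q} {q′} e f = coeffwise λ i → begin
    coeff (p ⊕ q) i          ≈⟨ coeff-⊕ p q i ⟩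
    coeff p i + coeff q i    ≈⟨ +-cong (coeff-≈ e i) (coeff-≈ f i) ⟩
    coeff p′ i + coeff q′ i  ≈⟨ coeff-⊕ p′ q′ i ⟨
    coeff (p′ ⊕ q′) i        ∎

  scale-cong : ∀ {a b q q′} → a ≈ b → q ≋ q′ → scale a q ≋ scale b q′
  scale-cong {a} {b} {q} {q′} a≈b e = coeffwise λ i → begin
    coeff (scale a q) i  ≈⟨ coeff-scale a q i ⟩
    a * coeff q i        ≈⟨ *-cong a≈b (coeff-≈ e i) ⟩
    b * coeff q′ i       ≈⟨ coeff-scale b q′ i ⟨
    coeff (scale b q′) i ∎

  neg-cong : ∀ {p q} → p ≋ q → neg p ≋ neg q
  neg-cong {p} {q} e = coeffwise λ i →
    trans (coeff-neg p i) (trans (-‿cong (coeff-≈ e i)) (sym (coeff-neg q i)))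

  ⊕-assoc : ∀ p q r → ((p ⊕ q) ⊕ r) ≋ (p ⊕ (q ⊕ r))
  ⊕-assoc p q r = coeffwise λ i → begin
    coeff ((p ⊕ q) ⊕ r) i                ≈⟨ trans (coeff-⊕ (p ⊕ q) r i) (+-congʳ (coeff-⊕ p q i)) ⟩
    coeff p i + coeff q i + coeff r i    ≈⟨ +-assoc _ _ _ ⟩
    coeff p i + (coeff q i + coeff r i)  ≈⟨ trans (coeff-⊕ p (q ⊕ r) i) (+-congˡ (coeff-⊕ q r i)) ⟨
    coeff (p ⊕ (q ⊕ r)) i                ∎

  ⊕-comm : ∀ p q → (p ⊕ q) ≋ (q ⊕ p)
  ⊕-comm p q = coeffwise λ i → trans (coeff-⊕ p q i) (trans (+-comm _ _) (sym (coeff-⊕ q p i)))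

  ⊕-identityʳ : ∀ p → (p ⊕ []) ≋ p
  ⊕-identityʳ p = coeffwise λ i → trans (coeff-⊕ p [] i) (+-identityʳ _)

  neg-inverseˡ : ∀ p → (neg p ⊕ p) ≋ []
  neg-inverseˡ p = coeffwise λ i →
    trans (coeff-⊕ (neg p) p i) (trans (+-congʳ (coeff-neg p i)) (-‿inverseˡ _))

  neg-inverseʳ : ∀ p → (p ⊕ neg p) ≋ []
  neg-inverseʳ p = ≋-trans (⊕-comm p (neg p)) (neg-inverseˡ p)

  0∷[]≋[] : (0# ∷ []) ≋ []
  0∷[]≋[] = coeffwise λ { zero → refl ; (suc i) → refl }

  ⊗-zeroʳ : ∀ p → (p ⊗ []) ≋ []
  ⊗-zeroʳ []      = ≋-refl
  ⊗-zeroʳ (a ∷ p) = ≋-trans (∷-cong refl (⊗-zeroʳ p)) 0∷[]≋[]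

  ⊗-annihilatedˡ : ∀ {p} q → p ≋ [] → (p ⊗ q) ≋ []
  ⊗-annihilatedˡ {[]}    q p≋0 = ≋-refl
  ⊗-annihilatedˡ {a ∷ p} q p≋0 = coeffwise λ i → begin
    coeff ((a ∷ p) ⊗ q) i                   ≈⟨ coeff-∷⊗ a p q i ⟩
    a * coeff q i + coeff (0# ∷ (p ⊗ q)) i  ≈⟨ +-cong (trans (*-congʳ (coeff-≈ p≋0 zero)) (zeroˡ _))
                                                       (coeff-≈ (∷-cong refl p⊗q≋0) i) ⟩
    0# + coeff (0# ∷ []) i                  ≈⟨ +-identityˡ _ ⟩
    coeff (0# ∷ []) i                       ≈⟨ coeff-≈ 0∷[]≋[] i ⟩
    coeff [] i                              ∎
    where
    p⊗q≋0 : (p ⊗ q) ≋ []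
    p⊗q≋0 = ⊗-annihilatedˡ {p} q (coeffwise λ j → coeff-≈ p≋0 (suc j))

  ⊕-leftComm : ∀ p q r → (p ⊕ (q ⊕ r)) ≋ (q ⊕ (p ⊕ r))
  ⊕-leftComm p q r = coeffwise λ i → begin
    coeff (p ⊕ (q ⊕ r)) i                ≈⟨ trans (coeff-⊕ p (q ⊕ r) i) (+-congˡ (coeff-⊕ q r i)) ⟩
    coeff p i + (coeff q i + coeff r i)  ≈⟨ +-leftComm _ _ _ ⟩
    coeff q i + (coeff p i + coeff r i)  ≈⟨ trans (coeff-⊕ q (p ⊕ r) i) (+-congˡ (coeff-⊕ p r i)) ⟨
    coeff (q ⊕ (p ⊕ r)) i                ∎

  ⊕-interchange : ∀ p q r u → ((p ⊕ q) ⊕ (r ⊕ u)) ≋ ((p ⊕ r) ⊕ (q ⊕ u))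
  ⊕-interchange p q r u = coeffwise λ i → begin
    coeff ((p ⊕ q) ⊕ (r ⊕ u)) i
      ≈⟨ trans (coeff-⊕ (p ⊕ q) _ i) (+-cong (coeff-⊕ p q i) (coeff-⊕ r u i)) ⟩
    (coeff p i + coeff q i) + (coeff r i + coeff u i)  ≈⟨ +-interchange _ _ _ _ ⟩
    (coeff p i + coeff r i) + (coeff q i + coeff u i)
      ≈⟨ trans (coeff-⊕ (p ⊕ r) _ i) (+-cong (coeff-⊕ p r i) (coeff-⊕ q u i)) ⟨
    coeff ((p ⊕ r) ⊕ (q ⊕ u)) i                        ∎

  0∷-⊕ : ∀ p q → (0# ∷ (p ⊕ q)) ≋ ((0# ∷ p) ⊕ (0# ∷ q))
  0∷-⊕ p q = ∷-cong (sym (+-identityˡ 0#)) ≋-refl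

  scale-⊕ : ∀ a p q → scale a (p ⊕ q) ≋ (scale a p ⊕ scale a q)
  scale-⊕ a p q = coeffwise λ i → begin
    coeff (scale a (p ⊕ q)) i               ≈⟨ trans (coeff-scale a (p ⊕ q) i) (*-congˡ (coeff-⊕ p q i)) ⟩
    a * (coeff p i + coeff q i)             ≈⟨ distribˡ a _ _ ⟩
    a * coeff p i + a * coeff q i           ≈⟨ +-cong (coeff-scale a p i) (coeff-scale a q i) ⟨
    coeff (scale a p) i + coeff (scale a q) i ≈⟨ coeff-⊕ (scale a p) _ i ⟨
    coeff (scale a p ⊕ scale a q) i         ∎

  scale-* : ∀ a b p → scale (a * b) p ≋ scale a (scale b p)
  scale-* a b p = coeffwise λ i → begin
    coeff (scale (a * b) p) i    ≈⟨ coeff-scale (a * b) p i ⟩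
    a * b * coeff p i            ≈⟨ *-assoc a b _ ⟩
    a * (b * coeff p i)          ≈⟨ trans (coeff-scale a (scale b p) i) (*-congˡ (coeff-scale b p i)) ⟨
    coeff (scale a (scale b p)) i ∎

  ⊗-congʳ : ∀ p {q q′} → q ≋ q′ → (p ⊗ q) ≋ (p ⊗ q′)
  ⊗-congʳ []      e = ≋-refl
  ⊗-congʳ (a ∷ p) e = ⊕-cong (scale-cong refl e) (∷-cong refl (⊗-congʳ p e))

  ⊗-congˡ : ∀ {p p′} q → p ≋ p′ → (p ⊗ q) ≋ (p′ ⊗ q)
  ⊗-congˡ {[]}    {p′}     q e = ≋-sym (⊗-annihilatedˡ q (≋-sym e))
  ⊗-congˡ {a ∷ p} {[]}     q e = ⊗-annihilatedˡ q e
  ⊗-congˡ {a ∷ p} {b ∷ p′} q e =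
    ⊕-cong (scale-cong (coeff-≈ e zero) ≋-refl)
           (∷-cong refl (⊗-congˡ {p} {p′} q (coeffwise λ i → coeff-≈ e (suc i))))

  ⊗-cong : ∀ {p p′ q q′} → p ≋ p′ → q ≋ q′ → (p ⊗ q) ≋ (p′ ⊗ q′)
  ⊗-cong {p′ = p′} {q} e f = ≋-trans (⊗-congˡ q e) (⊗-congʳ p′ f)

  ⊗-∷ʳ : ∀ p b q → (p ⊗ (b ∷ q)) ≋ (scale b p ⊕ (0# ∷ (p ⊗ q)))
  ⊗-∷ʳ []      b q = ≋-sym 0∷[]≋[]
  ⊗-∷ʳ (a ∷ p) b q = ∷-cong (+-congʳ (*-comm a b))
    (≋-trans (⊕-cong (≋-refl {scale a q}) (⊗-∷ʳ p b q)) (⊕-leftComm (scale a q) (scale b p) _))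

  ⊗-comm : ∀ p q → (p ⊗ q) ≋ (q ⊗ p)
  ⊗-comm []      q = ≋-sym (⊗-zeroʳ q)
  ⊗-comm (a ∷ p) q =
    ≋-trans (⊕-cong (≋-refl {scale a q}) (∷-cong refl (⊗-comm p q))) (≋-sym (⊗-∷ʳ q a p))

  ⊗-distribˡ : ∀ p q r → (p ⊗ (q ⊕ r)) ≋ ((p ⊗ q) ⊕ (p ⊗ r))
  ⊗-distribˡ []      q r = ≋-refl
  ⊗-distribˡ (a ∷ p) q r = ≋-trans
    (⊕-cong (scale-⊕ a q r) (≋-trans (∷-cong refl (⊗-distribˡ p q r)) (0∷-⊕ (p ⊗ q) (p ⊗ r))))
    (⊕-interchange (scale a q) (scale a r) (0# ∷ (p ⊗ q)) (0# ∷ (p ⊗ r)))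

  ⊗-distribʳ : ∀ r p q → ((p ⊕ q) ⊗ r) ≋ ((p ⊗ r) ⊕ (q ⊗ r))
  ⊗-distribʳ r p q = ≋-trans (⊗-comm (p ⊕ q) r)
    (≋-trans (⊗-distribˡ r p q) (⊕-cong (⊗-comm r p) (⊗-comm r q)))

  scale-⊗ : ∀ a p q → (scale a p ⊗ q) ≋ scale a (p ⊗ q)
  scale-⊗ a []      q = ≋-refl
  scale-⊗ a (b ∷ p) q = ≋-trans
    (⊕-cong (scale-* a b q) (∷-cong (sym (zeroʳ a)) (scale-⊗ a p q)))
    (≋-sym (scale-⊕ a (scale b q) _))

  0∷-⊗ : ∀ p q → ((0# ∷ p) ⊗ q) ≋ (0# ∷ (p ⊗ q))
  0∷-⊗ p q = coeffwise λ i →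
    trans (coeff-∷⊗ 0# p q i) (trans (+-congʳ (zeroˡ _)) (+-identityˡ _))

  ⊗-assoc : ∀ p q r → ((p ⊗ q) ⊗ r) ≋ (p ⊗ (q ⊗ r))
  ⊗-assoc []      q r = ≋-refl
  ⊗-assoc (a ∷ p) q r = ≋-trans (⊗-distribʳ r (scale a q) (0# ∷ (p ⊗ q)))
    (⊕-cong (scale-⊗ a q r) (≋-trans (0∷-⊗ (p ⊗ q) r) (∷-cong refl (⊗-assoc p q r))))

  ⊗-identityˡ : ∀ p → (const 1# ⊗ p) ≋ p
  ⊗-identityˡ p = coeffwise λ i → begin
    coeff (const 1# ⊗ p) i                ≈⟨ coeff-∷⊗ 1# [] p i ⟩
    1# * coeff p i + coeff (0# ∷ []) i    ≈⟨ +-cong (*-identityˡ _) (coeff-≈ 0∷[]≋[] i) ⟩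
    coeff p i + 0#                        ≈⟨ +-identityʳ _ ⟩
    coeff p i                             ∎

  ⊕-⊗-isCommutativeRing : IsCommutativeRing _≋_ _⊕_ _⊗_ neg [] (const 1#)
  ⊕-⊗-isCommutativeRing = record
    { isRing = record
      { +-isAbelianGroup = record
        { isGroup = record
          { isMonoid = record
            { isSemigroup = record
              { isMagma = record { isEquivalence = ≋-isEquivalence ; ∙-cong = ⊕-cong }
              ; assoc   = ⊕-assoc
              }
            ; identity = (λ _ → ≋-refl) , ⊕-identityʳ
            }
          ; inverse = neg-inverseˡ , neg-inverseʳ
          ; ⁻¹-cong = neg-cong
          }
        ; comm = ⊕-comm
        }
      ; *-cong     = ⊗-cong
      ; *-assoc    = ⊗-assoc
      ; *-identity = ⊗-identityˡ , λ p → ≋-trans (⊗-comm p (const 1#)) (⊗-identityˡ p)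
      ; distrib    = ⊗-distribˡ , ⊗-distribʳ
      }
    ; *-comm = ⊗-comm
    }

  polynomialRing : CommutativeRing 0ℓ ℓ
  polynomialRing = record { isCommutativeRing = ⊕-⊗-isCommutativeRing }

module PowerSeries {c ℓ} (R : CommutativeRing c ℓ) where

  open CommutativeRing R hiding (zero)
  open import Algebra.Properties.Semiring.Exp semiring using (_^_; ^-homo-*; ^-congʳ)
  open import Algebra.Properties.CommutativeSemigroup +-commutativeSemigroup
    using () renaming (interchange to +-interchange)
  open import Algebra.Properties.CommutativeSemigroup *-commutativeSemigroup
    using () renaming (interchange to *-interchange)
  open import Relation.Binary.Reasoning.Setoid setoid
  open ℤ-Solver R using (solve; _:+_; _:*_; _:=_)

  Series : Set c
  Series = ℕ → Carrier

  ∑[≤_] : ℕ → Series → Carrier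
  ∑[≤ zero  ] f = f zero
  ∑[≤ suc n ] f = ∑[≤ n ] f + f (suc n)

  ∑-cong : ∀ n {f g : Series} → (∀ j → j ≤ n → f j ≈ g j) → ∑[≤ n ] f ≈ ∑[≤ n ] g
  ∑-cong zero    f≈g = f≈g zero z≤n
  ∑-cong (suc n) f≈g =
    +-cong (∑-cong n λ j j≤n → f≈g j (ℕₚ.m≤n⇒m≤1+n j≤n)) (f≈g (suc n) ℕₚ.≤-refl)

  ∑-unconsˡ : ∀ n f → ∑[≤ suc n ] f ≈ f zero + ∑[≤ n ] (λ j → f (suc j))
  ∑-unconsˡ zero    f = refl
  ∑-unconsˡ (suc n) f = trans (+-congʳ (∑-unconsˡ n f)) (+-assoc _ _ _)

  ∑-zero : ∀ n f → (∀ j → f j ≈ 0#) → ∑[≤ n ] f ≈ 0#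
  ∑-zero zero    f f≈0 = f≈0 zero
  ∑-zero (suc n) f f≈0 = trans (+-cong (∑-zero n f f≈0) (f≈0 (suc n))) (+-identityˡ 0#)

  ∑-+ : ∀ n f g → ∑[≤ n ] (λ j → f j + g j) ≈ ∑[≤ n ] f + ∑[≤ n ] g
  ∑-+ zero    f g = refl
  ∑-+ (suc n) f g = trans (+-congʳ (∑-+ n f g)) (+-interchange _ _ _ _)

  ∑-*ˡ : ∀ n x f → ∑[≤ n ] (λ j → x * f j) ≈ x * ∑[≤ n ] f
  ∑-*ˡ zero    x f = refl
  ∑-*ˡ (suc n) x f = trans (+-congʳ (∑-*ˡ n x f)) (sym (distribˡ x _ _))

  infixl 7 _∗_
  _∗_ : Series → Series → Series
  (a ∗ b) n = ∑[≤ n ] λ j → a j * b (n ∸ j)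

  δ : Series
  δ zero    = 1#
  δ (suc n) = 0#

  shift : Series → Series
  shift a zero    = 0#
  shift a (suc j) = a j

  quadratic· : Carrier → Carrier → Series → Series
  quadratic· b c a j = a j + b * shift a j + c * shift (shift a) j

  dilate : Carrier → Series → Series
  dilate x a j = x ^ j * a j

  ∗-congˡ : ∀ {a a′} b n → (∀ j → a j ≈ a′ j) → (a ∗ b) n ≈ (a′ ∗ b) n
  ∗-congˡ b n a≈a′ = ∑-cong n λ j _ → *-congʳ (a≈a′ j)

  ∗-congʳ : ∀ a {b b′} n → (∀ j → b j ≈ b′ j) → (a ∗ b) n ≈ (a ∗ b′) n
  ∗-congʳ a n b≈b′ = ∑-cong n λ j _ → *-congˡ (b≈b′ (n ∸ j))

  δ-∗ : ∀ b n → (δ ∗ b) n ≈ b n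
  δ-∗ b zero    = *-identityˡ _
  δ-∗ b (suc n) = begin
    (δ ∗ b) (suc n)                                  ≈⟨ ∑-unconsˡ n (λ j → δ j * b (suc n ∸ j)) ⟩
    1# * b (suc n) + ∑[≤ n ] (λ j → 0# * b (n ∸ j))
      ≈⟨ +-cong (*-identityˡ _) (∑-zero n _ λ _ → zeroˡ _) ⟩
    b (suc n) + 0#                                   ≈⟨ +-identityʳ _ ⟩
    b (suc n)                                        ∎

  shift-∗ : ∀ a b n → (shift a ∗ b) n ≈ shift (a ∗ b) n
  shift-∗ a b zero    = zeroˡ _
  shift-∗ a b (suc n) = begin
    (shift a ∗ b) (suc n)                   ≈⟨ ∑-unconsˡ n (λ j → shift a j * b (suc n ∸ j)) ⟩
    0# * b (suc n) + (a ∗ b) n              ≈⟨ +-congʳ (zeroˡ _) ⟩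
    0# + (a ∗ b) n                          ≈⟨ +-identityˡ _ ⟩
    (a ∗ b) n                               ∎

  ∗-shift : ∀ a b n → (a ∗ shift b) n ≈ shift (a ∗ b) n
  ∗-shift a b zero    = zeroʳ _
  ∗-shift a b (suc n) = begin
    ∑[≤ n ] (λ j → a j * shift b (suc n ∸ j)) + a (suc n) * shift b (n ∸ n)
                                 ≈⟨ +-cong (∑-cong n shift-index) (*-congˡ last) ⟩
    (a ∗ b) n + a (suc n) * 0#   ≈⟨ +-congˡ (zeroʳ _) ⟩
    (a ∗ b) n + 0#               ≈⟨ +-identityʳ _ ⟩
    (a ∗ b) n                    ∎
    where
    shift-index : ∀ j → j ≤ n → a j * shift b (suc n ∸ j) ≈ a j * b (n ∸ j)
    shift-index j j≤n = reflexive (≡.cong (λ m → a j * shift b m) (ℕₚ.+-∸-assoc 1 j≤n))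
    last : shift b (n ∸ n) ≈ 0#
    last = reflexive (≡.cong (shift b) (ℕₚ.n∸n≡0 n))

  shift-swap : ∀ a b n → (shift a ∗ b) n ≈ (a ∗ shift b) n
  shift-swap a b n = trans (shift-∗ a b n) (sym (∗-shift a b n))

  quadratic·-∗ : ∀ b c a e n → (quadratic· b c a ∗ e) n ≈ (a ∗ quadratic· b c e) n
  quadratic·-∗ b c a e n = begin
    (quadratic· b c a ∗ e) n
      ≈⟨ ∑-cong n (λ j _ → distributeʳ (a j) (shift a j) (shift (shift a) j) (e (n ∸ j))) ⟩
    ∑[≤ n ] (λ j → a j * e (n ∸ j) + b * (shift a j * e (n ∸ j)) + c * (shift (shift a) j * e (n ∸ j)))
      ≈⟨ ∑-linear n _ _ _ ⟩
    (a ∗ e) n + b * (shift a ∗ e) n + c * (shift (shift a) ∗ e) n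
      ≈⟨ +-cong (+-congˡ (*-congˡ (shift-swap a e n)))
                (*-congˡ (trans (shift-swap (shift a) e n) (shift-swap a (shift e) n))) ⟩
    (a ∗ e) n + b * (a ∗ shift e) n + c * (a ∗ shift (shift e)) n
      ≈⟨ ∑-linear n _ _ _ ⟨
    ∑[≤ n ] (λ j → a j * e (n ∸ j) + b * (a j * shift e (n ∸ j)) + c * (a j * shift (shift e) (n ∸ j)))
      ≈⟨ ∑-cong n (λ j _ → distributeˡ (e (n ∸ j)) (shift e (n ∸ j)) (shift (shift e) (n ∸ j)) (a j)) ⟨
    (a ∗ quadratic· b c e) n ∎
    where
    ∑-linear : ∀ n f g h →
               ∑[≤ n ] (λ j → f j + b * g j + c * h j) ≈ ∑[≤ n ] f + b * ∑[≤ n ] g + c * ∑[≤ n ] h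
    ∑-linear n f g h = begin
      ∑[≤ n ] (λ j → f j + b * g j + c * h j)            ≈⟨ ∑-+ n _ _ ⟩
      ∑[≤ n ] (λ j → f j + b * g j) + ∑[≤ n ] (λ j → c * h j)
        ≈⟨ +-cong (∑-+ n _ _) (∑-*ˡ n c h) ⟩
      ∑[≤ n ] f + ∑[≤ n ] (λ j → b * g j) + c * ∑[≤ n ] h ≈⟨ +-congʳ (+-congˡ (∑-*ˡ n b g)) ⟩
      ∑[≤ n ] f + b * ∑[≤ n ] g + c * ∑[≤ n ] h          ∎
    distributeʳ : ∀ x y z w → (x + b * y + c * z) * w ≈ x * w + b * (y * w) + c * (z * w)
    distributeʳ = solve 6 (λ b c x y z w → (x :+ b :* y :+ c :* z) :* w
                             := x :* w :+ b :* (y :* w) :+ c :* (z :* w)) refl b c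
    distributeˡ : ∀ x y z w → w * (x + b * y + c * z) ≈ w * x + b * (w * y) + c * (w * z)
    distributeˡ = solve 6 (λ b c x y z w → w :* (x :+ b :* y :+ c :* z)
                             := w :* x :+ b :* (w :* y) :+ c :* (w :* z)) refl b c

  quadratic·-inverse : ∀ b c {d e} → (∀ j → d j ≈ quadratic· b c δ j) →
                       (∀ n → quadratic· b c e n ≈ δ n) → ∀ n → (d ∗ e) n ≈ δ n
  quadratic·-inverse b c {d} {e} d≈ e≈ n = begin
    (d ∗ e) n                  ≈⟨ ∗-congˡ e n d≈ ⟩
    (quadratic· b c δ ∗ e) n   ≈⟨ quadratic·-∗ b c δ e n ⟩
    (δ ∗ quadratic· b c e) n   ≈⟨ δ-∗ (quadratic· b c e) n ⟩
    quadratic· b c e n         ≈⟨ e≈ n ⟩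
    δ n                        ∎

  dilate-∗ : ∀ x a b n → (dilate x a ∗ dilate x b) n ≈ x ^ n * (a ∗ b) n
  dilate-∗ x a b n = trans (∑-cong n factor) (∑-*ˡ n (x ^ n) λ j → a j * b (n ∸ j))
    where
    factor : ∀ j → j ≤ n → x ^ j * a j * (x ^ (n ∸ j) * b (n ∸ j)) ≈ x ^ n * (a j * b (n ∸ j))
    factor j j≤n = begin
      x ^ j * a j * (x ^ (n ∸ j) * b (n ∸ j))    ≈⟨ *-interchange _ _ _ _ ⟩
      x ^ j * x ^ (n ∸ j) * (a j * b (n ∸ j))    ≈⟨ *-congʳ (^-homo-* x j (n ∸ j)) ⟨
      x ^ (j ℕ.+ (n ∸ j)) * (a j * b (n ∸ j))    ≈⟨ *-congʳ (^-congʳ x (ℕₚ.m+[n∸m]≡n j≤n)) ⟩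
      x ^ n * (a j * b (n ∸ j))                  ∎

  dilate-δ : ∀ x n → dilate x δ n ≈ δ n
  dilate-δ x zero    = *-identityʳ 1#
  dilate-δ x (suc n) = zeroʳ _

module FibonacciPolynomials {r ℓ} (R : CommutativeRing r ℓ) (s t : CommutativeRing.Carrier R) where

  open CommutativeRing R hiding (zero)
  open import Algebra.Properties.Semiring.Exp semiring using (_^_; ^-homo-*)
  open import Algebra.Properties.CommutativeSemigroup *-commutativeSemigroup using (x∙yz≈y∙xz)
  open import Relation.Binary.Reasoning.Setoid setoid
  open ℤ-Solver R using (solve; _:+_; _:*_; :-_; _:-_; _:=_; :0; :1)

  F : ℕ → Carrier
  F zero          = 0#
  F (suc zero)    = 1#
  F (suc (suc n)) = s * F (suc n) + t * F n

  -- τ = α β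
  τ : Carrier
  τ = - t

  -- L n = αⁿ⁺¹ + βⁿ⁺¹, the Lucas polynomial of index n + 1
  L : ℕ → Carrier
  L n = F (suc (suc n)) + t * F n

  F-cong : ∀ {m n} → m ≡.≡ n → F m ≈ F n
  F-cong m≡n = reflexive (≡.cong F m≡n)

  L-cong : ∀ {m n} → m ≡.≡ n → L m ≈ L n
  L-cong m≡n = reflexive (≡.cong L m≡n)

  F-addition : ∀ m n → F (suc (m ℕ.+ n)) ≈ F (suc m) * F (suc n) + t * F m * F n
  F-addition zero    n = solve 3 (λ a b t → a := :1 :* a :+ t :* :0 :* b) refl (F (suc n)) (F n) t
  F-addition (suc m) n = begin
    F (suc (suc (m ℕ.+ n)))                              ≈⟨ F-cong (≡.cong suc (ℕₚ.+-suc m n)) ⟨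
    F (suc (m ℕ.+ suc n))                                ≈⟨ F-addition m (suc n) ⟩
    F (suc m) * (s * F (suc n) + t * F n) + t * F m * F (suc n)
      ≈⟨ solve 6 (λ s t a b c d → a :* (s :* c :+ t :* d) :+ t :* b :* c := (s :* a :+ t :* b) :* c :+ t :* a :* d)
                refl s t (F (suc m)) (F m) (F (suc n)) (F n) ⟩
    F (suc (suc m)) * F (suc n) + t * F (suc m) * F n    ∎

  cassini′ : ∀ n → F (suc (suc n)) * F n ≈ F (suc n) * F (suc n) - τ ^ n

  cassini : ∀ n → F (suc (suc n)) * F n + τ ^ n ≈ F (suc n) * F (suc n)
  cassini zero    = solve 1 (λ a → a :* :0 :+ :1 := :1 :* :1) refl (F 2)
  cassini (suc n) = begin
    (s * a + t * b) * b + τ * τ ^ n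
      ≈⟨ solve 5 (λ s t a b p → (s :* a :+ t :* b) :* b :+ (:- t) :* p := s :* a :* b :+ t :* (b :* b :- p))
                refl s t a b (τ ^ n) ⟩
    s * a * b + t * (b * b - τ ^ n)   ≈⟨ +-congˡ (*-congˡ (cassini′ n)) ⟨
    s * a * b + t * (a * c)
      ≈⟨ solve 5 (λ s t a b c → s :* a :* b :+ t :* (a :* c) := a :* (s :* b :+ t :* c)) refl s t a b c ⟩
    a * a                             ∎
    where
    a b c : Carrier
    a = F (suc (suc n))
    b = F (suc n)
    c = F n

  cassini′ n = trans (solve 2 (λ x y → x := (x :+ y) :- y) refl _ (τ ^ n)) (+-congʳ (cassini n))

  -- B a b is the Fibonomial {a + b choose a}; indexing by the two parts keeps the Pascal
  -- recurrence free of truncated subtraction.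
  B : ℕ → ℕ → Carrier
  B zero    b       = 1#
  B (suc a) zero    = 1#
  B (suc a) (suc b) = F (suc (suc b)) * B a (suc b) + t * F a * B (suc a) b

  B-cong : ∀ {a a′ b} → a ≡.≡ a′ → B a b ≈ B a′ b
  B-cong a≡a′ = reflexive (≡.cong (λ a → B a _) a≡a′)

  B-zeroʳ : ∀ a → B a 0 ≈ 1#
  B-zeroʳ zero    = refl
  B-zeroʳ (suc a) = refl

  B-oneˡ : ∀ b → B 1 b ≈ F (suc b)
  B-oneˡ zero    = refl
  B-oneˡ (suc b) = solve 3 (λ a t x → a :* :1 :+ t :* :0 :* x := a) refl (F (suc (suc b))) t (B 1 b)

  B-oneʳ : ∀ a → B a 1 ≈ F (suc a)
  B-oneʳ zero    = refl
  B-oneʳ (suc a) = begin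
    F 2 * B a 1 + t * F a * 1#        ≈⟨ +-congʳ (*-congˡ (B-oneʳ a)) ⟩
    F 2 * F (suc a) + t * F a * 1#
      ≈⟨ solve 4 (λ s t x y → (s :* :1 :+ t :* :0) :* x :+ t :* y :* :1 := s :* x :+ t :* y)
                refl s t (F (suc a)) (F a) ⟩
    F (suc (suc a))                   ∎

  B-ratio : ∀ a b → F (suc b) * B a (suc b) ≈ F (suc a) * B (suc a) b
  B-ratio zero    b       = trans (*-identityʳ _) (trans (sym (B-oneˡ b)) (sym (*-identityˡ _)))
  B-ratio (suc a) zero    = trans (*-identityˡ _) (trans (B-oneʳ (suc a)) (sym (*-identityʳ _)))
  B-ratio (suc a) (suc b) = begin
    F (suc (suc b)) * (F (suc (suc (suc b))) * B a (suc (suc b)) + t * F a * X)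
      ≈⟨ solve 6 (λ f₂ f₃ y t f x → f₂ :* (f₃ :* y :+ t :* f :* x)
                    := f₃ :* (f₂ :* y) :+ t :* f :* f₂ :* x) refl _ _ _ t _ _ ⟩
    F (suc (suc (suc b))) * (F (suc (suc b)) * B a (suc (suc b))) + t * F a * F (suc (suc b)) * X
      ≈⟨ +-congʳ (*-congˡ (B-ratio a (suc b))) ⟩
    F (suc (suc (suc b))) * (F (suc a) * X) + t * F a * F (suc (suc b)) * X
      ≈⟨ solve 6 (λ f₃ g t f f₂ x → f₃ :* (g :* x) :+ t :* f :* f₂ :* x
                    := (g :* f₃ :+ t :* f :* f₂) :* x) refl _ _ t _ _ X ⟩
    (F (suc a) * F (suc (suc (suc b))) + t * F a * F (suc (suc b))) * X
      ≈⟨ *-congʳ (sym (F-addition a (suc (suc b)))) ⟩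
    F (suc (a ℕ.+ suc (suc b))) * X                 ≈⟨ *-congʳ (F-cong (≡.cong suc (ℕₚ.+-suc a (suc b)))) ⟩
    F (suc (suc a ℕ.+ suc b)) * X                   ≈⟨ *-congʳ (F-addition (suc a) (suc b)) ⟩
    (F (suc (suc a)) * F (suc (suc b)) + t * F (suc a) * F (suc b)) * X
      ≈⟨ solve 6 (λ g₂ f₂ t g₁ f₁ x → (g₂ :* f₂ :+ t :* g₁ :* f₁) :* x
                    := g₂ :* (f₂ :* x) :+ t :* g₁ :* (f₁ :* x)) refl _ _ t _ _ X ⟩
    F (suc (suc a)) * (F (suc (suc b)) * X) + t * F (suc a) * (F (suc b) * X)
      ≈⟨ +-congˡ (*-congˡ (B-ratio (suc a) b)) ⟩
    F (suc (suc a)) * (F (suc (suc b)) * X) + t * F (suc a) * (F (suc (suc a)) * B (suc (suc a)) b)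
      ≈⟨ solve 6 (λ g₂ f₂ x t g₁ z → g₂ :* (f₂ :* x) :+ t :* g₁ :* (g₂ :* z)
                    := g₂ :* (f₂ :* x :+ t :* g₁ :* z)) refl _ _ _ t _ _ ⟩
    F (suc (suc a)) * B (suc (suc a)) (suc b)       ∎
    where
    X : Carrier
    X = B (suc a) (suc b)

  B-pascal′ : ∀ a b → B (suc a) (suc b) ≈ F (suc (suc a)) * B (suc a) b + t * F b * B a (suc b)
  B-pascal′ a b = begin
    F (suc (suc b)) * Y + t * F a * Z
      ≈⟨ solve 7 (λ s t f₁ f₀ y g z → (s :* f₁ :+ t :* f₀) :* y :+ t :* g :* z
                    := s :* (f₁ :* y) :+ t :* f₀ :* y :+ t :* g :* z)
                refl s t (F (suc b)) (F b) Y (F a) Z ⟩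
    s * (F (suc b) * Y) + t * F b * Y + t * F a * Z    ≈⟨ +-congʳ (+-congʳ (*-congˡ (B-ratio a b))) ⟩
    s * (F (suc a) * Z) + t * F b * Y + t * F a * Z
      ≈⟨ solve 7 (λ s t g₁ f₀ y g z → s :* (g₁ :* z) :+ t :* f₀ :* y :+ t :* g :* z
                    := (s :* g₁ :+ t :* g) :* z :+ t :* f₀ :* y)
                refl s t (F (suc a)) (F b) Y (F a) Z ⟩
    F (suc (suc a)) * Z + t * F b * Y                  ∎
    where
    Y Z : Carrier
    Y = B a (suc b)
    Z = B (suc a) b

  B-absorption : ∀ a b → F (suc a) * B (suc a) b ≈ F (suc (a ℕ.+ b)) * B a b
  B-absorption zero    b = sym (B-ratio zero b)
  B-absorption (suc a) b = begin
    F (suc (suc a)) * B (suc (suc a)) b                  ≈⟨ B-ratio (suc a) b ⟨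
    F (suc b) * B (suc a) (suc b)                        ≈⟨ *-congˡ (B-pascal′ a b) ⟩
    F (suc b) * (F (suc (suc a)) * Z + t * F b * B a (suc b))
      ≈⟨ solve 6 (λ f₁ g₂ z t f₀ y → f₁ :* (g₂ :* z :+ t :* f₀ :* y)
                    := f₁ :* g₂ :* z :+ t :* f₀ :* (f₁ :* y)) refl _ _ Z t _ _ ⟩
    F (suc b) * F (suc (suc a)) * Z + t * F b * (F (suc b) * B a (suc b))
      ≈⟨ +-congˡ (*-congˡ (B-ratio a b)) ⟩
    F (suc b) * F (suc (suc a)) * Z + t * F b * (F (suc a) * Z)
      ≈⟨ solve 6 (λ f₁ g₂ z t f₀ g₁ → f₁ :* g₂ :* z :+ t :* f₀ :* (g₁ :* z)
                    := (g₂ :* f₁ :+ t :* g₁ :* f₀) :* z) refl _ _ Z t _ _ ⟩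
    (F (suc (suc a)) * F (suc b) + t * F (suc a) * F b) * Z  ≈⟨ *-congʳ (F-addition (suc a) b) ⟨
    F (suc (suc a ℕ.+ b)) * Z                            ∎
    where
    Z : Carrier
    Z = B (suc a) b

  tF-B-split : ∀ a b → t * F a * B (suc a) (suc b) ≈
    τ ^ suc a * B (suc a) b + t * F (suc (a ℕ.+ b)) * B a (suc b)
  tF-B-split a b = begin
    t * F a * X                                        ≈⟨ *-congˡ (B-pascal′ a b) ⟩
    t * F a * (F (suc (suc a)) * Z + t * F b * Y)
      ≈⟨ solve 6 (λ t f g₂ z f′ y → t :* f :* (g₂ :* z :+ t :* f′ :* y)
                    := t :* (g₂ :* f) :* z :+ t :* t :* f :* f′ :* y) refl t _ _ Z _ Y ⟩
    t * (F (suc (suc a)) * F a) * Z + t * t * F a * F b * Y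
      ≈⟨ +-congʳ (*-congʳ (*-congˡ (cassini′ a))) ⟩
    t * (F (suc a) * F (suc a) - τ ^ a) * Z + t * t * F a * F b * Y
      ≈⟨ solve 7 (λ t g p z f f′ y → t :* (g :* g :- p) :* z :+ t :* t :* f :* f′ :* y
                    := t :* g :* (g :* z) :+ (:- t) :* p :* z :+ t :* t :* f :* f′ :* y)
                refl t _ _ Z _ _ Y ⟩
    t * F (suc a) * (F (suc a) * Z) + τ * τ ^ a * Z + t * t * F a * F b * Y
      ≈⟨ +-congʳ (+-congʳ (*-congˡ (B-ratio a b))) ⟨
    t * F (suc a) * (F (suc b) * Y) + τ * τ ^ a * Z + t * t * F a * F b * Y
      ≈⟨ solve 8 (λ t g g′ y p z f f′ → t :* g :* (g′ :* y) :+ (:- t) :* p :* z :+ t :* t :* f :* f′ :* y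
                    := (:- t) :* p :* z :+ t :* (g :* g′ :+ t :* f :* f′) :* y)
                refl t _ _ Y _ Z _ _ ⟩
    τ * τ ^ a * Z + t * (F (suc a) * F (suc b) + t * F a * F b) * Y
      ≈⟨ +-congˡ (*-congʳ (*-congˡ (F-addition a b))) ⟨
    τ ^ suc a * Z + t * F (suc (a ℕ.+ b)) * Y          ∎
    where
    X Y Z : Carrier
    X = B (suc a) (suc b)
    Y = B a (suc b)
    Z = B (suc a) b

  B-lucas : ∀ a b → L a * B (suc a) (suc b) ≈
    L (suc (a ℕ.+ b)) * B a (suc b) + (1# + 1#) * (τ ^ suc a * B (suc a) b)
  B-lucas a b = begin
    (s * F (suc a) + t * F a + t * F a) * X
      ≈⟨ solve 5 (λ s g t f x → (s :* g :+ t :* f :+ t :* f) :* x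
                    := s :* (g :* x) :+ (:1 :+ :1) :* (t :* f :* x)) refl s _ t _ X ⟩
    s * (F (suc a) * X) + (1# + 1#) * (t * F a * X)
      ≈⟨ +-cong (*-congˡ (B-absorption a (suc b))) (*-congˡ (tF-B-split a b)) ⟩
    s * (F (suc (a ℕ.+ suc b)) * Y) + (1# + 1#) * (τ ^ suc a * Z + t * F (suc (a ℕ.+ b)) * Y)
      ≈⟨ +-congʳ (*-congˡ (*-congʳ (F-cong (≡.cong suc (ℕₚ.+-suc a b))))) ⟩
    s * (F (suc (suc (a ℕ.+ b))) * Y) + (1# + 1#) * (τ ^ suc a * Z + t * F (suc (a ℕ.+ b)) * Y)
      ≈⟨ solve 7 (λ s f₂ y p z t f₁ → s :* (f₂ :* y) :+ (:1 :+ :1) :* (p :* z :+ t :* f₁ :* y)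
                    := (s :* f₂ :+ t :* f₁ :+ t :* f₁) :* y :+ (:1 :+ :1) :* (p :* z))
                refl s _ Y _ Z t _ ⟩
    L (suc (a ℕ.+ b)) * Y + (1# + 1#) * (τ ^ suc a * Z) ∎
    where
    X Y Z : Carrier
    X = B (suc a) (suc b)
    Y = B a (suc b)
    Z = B (suc a) b

  F-B-split : ∀ a b → F (suc (suc (a ℕ.+ b))) * B (suc a) (suc b) ≈
    F (suc (suc b)) * F (suc (suc b)) * B a (suc (suc b)) + t * F (suc (suc a)) * F a * B (suc (suc a)) b
  F-B-split a b = begin
    F (suc (suc (a ℕ.+ b))) * X                    ≈⟨ *-congʳ (F-cong (≡.cong suc (ℕₚ.+-suc a b))) ⟨
    F (suc (a ℕ.+ suc b)) * X                      ≈⟨ *-congʳ (F-addition a (suc b)) ⟩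
    (F (suc a) * F (suc (suc b)) + t * F a * F (suc b)) * X
      ≈⟨ solve 6 (λ f₂ g₁ x t g f₁ → (g₁ :* f₂ :+ t :* g :* f₁) :* x
                                     := f₂ :* (g₁ :* x) :+ t :* g :* (f₁ :* x))
                refl _ _ X t _ _ ⟩
    F (suc (suc b)) * (F (suc a) * X) + t * F a * (F (suc b) * X)
      ≈⟨ +-cong (*-congˡ (B-ratio a (suc b))) (*-congˡ (sym (B-ratio (suc a) b))) ⟨
    F (suc (suc b)) * (F (suc (suc b)) * Y) + t * F a * (F (suc (suc a)) * Z)
      ≈⟨ solve 6 (λ f₂ y t g₂ g z → f₂ :* (f₂ :* y) :+ t :* g :* (g₂ :* z)
                                    := f₂ :* f₂ :* y :+ t :* g₂ :* g :* z)
                refl _ Y t _ _ Z ⟩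
    F (suc (suc b)) * F (suc (suc b)) * Y + t * F (suc (suc a)) * F a * Z ∎
    where
    X Y Z : Carrier
    X = B (suc a) (suc b)
    Y = B a (suc (suc b))
    Z = B (suc (suc a)) b

  B-three-term : ∀ a b → B (suc (suc a)) (suc (suc b)) ≈
    τ ^ suc (suc a) * B (suc (suc a)) b + L (suc (suc (a ℕ.+ b))) * B (suc a) (suc b)
      + τ ^ suc (suc b) * B a (suc (suc b))
  B-three-term a b = begin
    f₃ * B (suc a) (suc (suc b)) + t * g₁ * (f₂ * X + t * g₁ * Z)
      ≈⟨ +-congʳ (*-congˡ (B-pascal′ a (suc b))) ⟩
    f₃ * (g₂ * X + t * f₁ * Y) + t * g₁ * (f₂ * X + t * g₁ * Z)
      ≈⟨ solve 9 (λ f₃ g₂ x t f₁ y g₁ f₂ z →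
                    f₃ :* (g₂ :* x :+ t :* f₁ :* y) :+ t :* g₁ :* (f₂ :* x :+ t :* g₁ :* z)
                    := (g₂ :* f₃ :+ t :* g₁ :* f₂) :* x :+ t :* (f₃ :* f₁) :* y :+ t :* t :* (g₁ :* g₁) :* z)
                refl _ _ X t _ Y _ _ Z ⟩
    (g₂ * f₃ + t * g₁ * f₂) * X + t * (f₃ * f₁) * Y + t * t * (g₁ * g₁) * Z
      ≈⟨ +-cong (+-cong (*-congʳ (trans (sym (F-addition (suc a) (suc (suc b)))) (F-cong index)))
                        (*-congʳ (*-congˡ (cassini′ (suc b)))))
                (*-congʳ (*-congˡ (sym (cassini a)))) ⟩
    F (4+ (a ℕ.+ b)) * X + t * (f₂ * f₂ - τ ^ suc b) * Y + t * t * (g₂ * g₀ + τ ^ a) * Z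
      ≈⟨ solve 10 (λ f₄ x t f₂ p y g₂ g₀ q z →
             f₄ :* x :+ t :* (f₂ :* f₂ :- p) :* y :+ t :* t :* (g₂ :* g₀ :+ q) :* z
             := f₄ :* x :+ t :* (f₂ :* f₂ :* y :+ t :* g₂ :* g₀ :* z)
                :+ (:- t) :* ((:- t) :* q) :* z :+ (:- t) :* p :* y)
                refl _ X t _ _ Y _ _ _ Z ⟩
    F (4+ (a ℕ.+ b)) * X + t * (f₂ * f₂ * Y + t * g₂ * g₀ * Z) + τ ^ suc (suc a) * Z + τ ^ suc (suc b) * Y
      ≈⟨ +-congʳ (+-congʳ (+-congˡ (*-congˡ (F-B-split a b)))) ⟨
    F (4+ (a ℕ.+ b)) * X + t * (F (suc (suc (a ℕ.+ b))) * X) + τ ^ suc (suc a) * Z + τ ^ suc (suc b) * Y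
      ≈⟨ solve 7 (λ f₄ x t f p z q → f₄ :* x :+ t :* (f :* x) :+ p :* z :+ q
                                     := p :* z :+ (f₄ :+ t :* f) :* x :+ q)
                refl _ X t _ _ Z _ ⟩
    τ ^ suc (suc a) * Z + L (suc (suc (a ℕ.+ b))) * X + τ ^ suc (suc b) * Y ∎
    where
    4+ : ℕ → ℕ
    4+ n = suc (suc (suc (suc n)))
    index : suc (suc a ℕ.+ suc (suc b)) ≡.≡ 4+ (a ℕ.+ b)
    index = ≡.cong (λ n → suc (suc n)) (≡.trans (ℕₚ.+-suc a (suc b)) (≡.cong suc (ℕₚ.+-suc a b)))
    f₁ f₂ f₃ g₀ g₁ g₂ X Y Z : Carrier
    f₁ = F (suc b)
    f₂ = F (suc (suc b))
    f₃ = F (suc (suc (suc b)))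
    g₀ = F a
    g₁ = F (suc a)
    g₂ = F (suc (suc a))
    X  = B (suc a) (suc b)
    Y  = B a (suc (suc b))
    Z  = B (suc (suc a)) b

  B-recurrence : ∀ a b → B (suc (suc a)) (suc (suc b)) ≈
    L (suc a) * B (suc (suc a)) (suc b) - τ ^ suc (suc a) * B (suc (suc a)) b + τ ^ suc (suc b) * B a (suc (suc b))
  B-recurrence a b = begin
    B (suc (suc a)) (suc (suc b))                                   ≈⟨ B-three-term a b ⟩
    τ ^ suc (suc a) * Z + L (suc (suc (a ℕ.+ b))) * X + τ ^ suc (suc b) * Y
      ≈⟨ solve 6 (λ p z l x q y → p :* z :+ l :* x :+ q :* y
                    := (l :* x :+ (:1 :+ :1) :* (p :* z)) :- p :* z :+ q :* y) refl _ Z _ X _ Y ⟩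
    L (suc (suc (a ℕ.+ b))) * X + (1# + 1#) * (τ ^ suc (suc a) * Z) - τ ^ suc (suc a) * Z + τ ^ suc (suc b) * Y
      ≈⟨ +-congʳ (+-congʳ (B-lucas (suc a) b)) ⟨
    L (suc a) * B (suc (suc a)) (suc b) - τ ^ suc (suc a) * Z + τ ^ suc (suc b) * Y ∎
    where
    X Y Z : Carrier
    X = B (suc a) (suc b)
    Y = B a (suc (suc b))
    Z = B (suc (suc a)) b

  F-falling : ℕ → ℕ → Carrier
  F-falling n zero    = 1#
  F-falling n (suc k) = F (n ∸ k) * F-falling n k

  F-falling-suc : ∀ n k → F-falling (suc n) (suc k) ≈ F (suc n) * F-falling n k
  F-falling-suc n zero    = refl
  F-falling-suc n (suc k) = begin
    F (n ∸ k) * F-falling (suc n) (suc k)     ≈⟨ *-congˡ (F-falling-suc n k) ⟩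
    F (n ∸ k) * (F (suc n) * F-falling n k)   ≈⟨ x∙yz≈y∙xz _ _ _ ⟩
    F (suc n) * (F (n ∸ k) * F-falling n k)   ∎

  B-falling : ∀ a b → B a b * F-falling a a ≈ F-falling (a ℕ.+ b) a
  B-falling zero    b       = *-identityˡ 1#
  B-falling (suc a) zero    =
    trans (*-identityˡ _) (reflexive (≡.cong (λ n → F-falling n (suc a)) (≡.sym (ℕₚ.+-identityʳ (suc a)))))
  B-falling (suc a) (suc b) = begin
    (F (suc (suc b)) * B a (suc b) + t * F a * B (suc a) b) * F-falling (suc a) (suc a)
      ≈⟨ distribʳ _ _ _ ⟩
    F (suc (suc b)) * B a (suc b) * F-falling (suc a) (suc a) + t * F a * B (suc a) b * F-falling (suc a) (suc a)
      ≈⟨ +-cong (trans (*-congˡ (F-falling-suc a a)) (rearrange _ _ _ _)) (*-assoc _ _ _) ⟩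
    F (suc (suc b)) * (F (suc a) * (B a (suc b) * F-falling a a)) + t * F a * (B (suc a) b * F-falling (suc a) (suc a))
      ≈⟨ +-cong (*-congˡ (*-congˡ (B-falling a (suc b)))) (*-congˡ (B-falling (suc a) b)) ⟩
    F (suc (suc b)) * (F (suc a) * P) + t * F a * F-falling (suc a ℕ.+ b) (suc a)
      ≈⟨ +-congˡ (*-congˡ (reflexive (≡.cong (λ n → F-falling n (suc a)) (≡.sym (ℕₚ.+-suc a b))))) ⟩
    F (suc (suc b)) * (F (suc a) * P) + t * F a * (F ((a ℕ.+ suc b) ∸ a) * P)
      ≈⟨ +-congˡ (*-congˡ (*-congʳ (F-cong (ℕₚ.m+n∸m≡n a (suc b))))) ⟩
    F (suc (suc b)) * (F (suc a) * P) + t * F a * (F (suc b) * P)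
      ≈⟨ solve 6 (λ f₂ g₁ p t g f₁ → f₂ :* (g₁ :* p) :+ t :* g :* (f₁ :* p)
                    := (g₁ :* f₂ :+ t :* g :* f₁) :* p) refl _ _ P t _ _ ⟩
    (F (suc a) * F (suc (suc b)) + t * F a * F (suc b)) * P        ≈⟨ *-congʳ (F-addition a (suc b)) ⟨
    F (suc (a ℕ.+ suc b)) * P                                      ≈⟨ F-falling-suc (a ℕ.+ suc b) a ⟨
    F-falling (suc (a ℕ.+ suc b)) (suc a)                          ∎
    where
    P : Carrier
    P = F-falling (a ℕ.+ suc b) a
    rearrange : ∀ x y z w → x * y * (z * w) ≈ x * (z * (y * w))
    rearrange = solve 4 (λ x y z w → x :* y :* (z :* w) := x :* (z :* (y :* w))) refl

  -- binomFrom a j n = {a + n choose a + j}, which is 0 for j > n; so binom n j = {n choose j}.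
  binomFrom : ℕ → ℕ → ℕ → Carrier
  binomFrom a zero    n       = B a n
  binomFrom a (suc j) zero    = 0#
  binomFrom a (suc j) (suc n) = binomFrom (suc a) j n

  binom : ℕ → ℕ → Carrier
  binom n j = binomFrom 0 j n

  binom-cong : ∀ j {n n′} → n ≡.≡ n′ → binom n j ≈ binom n′ j
  binom-cong j n≡n′ = reflexive (≡.cong (λ n → binom n j) n≡n′)

  binomFrom-B : ∀ a j m → binomFrom a j (j ℕ.+ m) ≈ B (j ℕ.+ a) m
  binomFrom-B a zero    m = refl
  binomFrom-B a (suc j) m = trans (binomFrom-B (suc a) j m) (B-cong (ℕₚ.+-suc j a))

  binom-B : ∀ j m → binom (j ℕ.+ m) j ≈ B j m
  binom-B j m = trans (binomFrom-B 0 j m) (B-cong (ℕₚ.+-identityʳ j))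

  binomFrom-vanishes : ∀ a {n j} → n < j → binomFrom a j n ≈ 0#
  binomFrom-vanishes a {zero}  {suc j} _         = refl
  binomFrom-vanishes a {suc n} {suc j} (s≤s n<j) = binomFrom-vanishes (suc a) n<j

  B-three-term′ : ∀ j m → B (suc (suc j)) m ≈
    τ ^ suc (suc j) * binom (j ℕ.+ m) (suc (suc j)) + L (j ℕ.+ m) * binom (j ℕ.+ m) (suc j) + τ ^ m * B j m
  B-three-term′ j zero = begin
    1#                                    ≈⟨ solve 2 (λ p l → :1 := p :* :0 :+ l :* :0 :+ :1 :* :1) refl _ _ ⟩
    τ ^ suc (suc j) * 0# + L (j ℕ.+ 0) * 0# + 1# * 1#
      ≈⟨ +-cong (+-cong (*-congˡ (binomFrom-vanishes 0 (ℕₚ.m<n⇒m<1+n j+0<1+j)))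
                        (*-congˡ (binomFrom-vanishes 0 j+0<1+j)))
                (*-congˡ (B-zeroʳ j)) ⟨
    τ ^ suc (suc j) * binom (j ℕ.+ 0) (suc (suc j)) + L (j ℕ.+ 0) * binom (j ℕ.+ 0) (suc j)
      + τ ^ 0 * B j 0                     ∎
    where
    j+0<1+j : j ℕ.+ 0 < suc j
    j+0<1+j = ≡.subst (_< suc j) (≡.sym (ℕₚ.+-identityʳ j)) (ℕₚ.n<1+n j)
  B-three-term′ j (suc zero) = begin
    B (suc (suc j)) 1                                          ≈⟨ B-oneʳ (suc (suc j)) ⟩
    F (suc (suc (suc j)))
      ≈⟨ solve 4 (λ f₃ f₁ t p → f₃ := p :* :0 :+ (f₃ :+ t :* f₁) :* :1 :+ (:- t) :* f₁)
                refl _ (F (suc j)) t _ ⟩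
    τ ^ suc (suc j) * 0# + L (suc j) * 1# + τ * F (suc j)
      ≈⟨ +-cong (+-cong (*-congˡ (binomFrom-vanishes 0 j+1<2+j)) (*-cong (L-cong j+1≡1+j) binom-diagonal))
                (*-cong (*-identityʳ τ) (B-oneʳ j)) ⟨
    τ ^ suc (suc j) * binom (j ℕ.+ 1) (suc (suc j)) + L (j ℕ.+ 1) * binom (j ℕ.+ 1) (suc j)
      + τ ^ 1 * B j 1                                          ∎
    where
    j+1≡1+j : j ℕ.+ 1 ≡.≡ suc j
    j+1≡1+j = ℕₚ.+-comm j 1
    j+1<2+j : j ℕ.+ 1 < suc (suc j)
    j+1<2+j = ≡.subst (_< suc (suc j)) (≡.sym j+1≡1+j) (ℕₚ.n<1+n (suc j))
    binom-diagonal : binom (j ℕ.+ 1) (suc j) ≈ 1#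
    binom-diagonal =
      trans (binom-cong (suc j) (≡.trans j+1≡1+j (≡.sym (ℕₚ.+-identityʳ (suc j))))) (binom-B (suc j) 0)
  B-three-term′ j (suc (suc m)) = begin
    B (suc (suc j)) (suc (suc m))                              ≈⟨ B-three-term j m ⟩
    τ ^ suc (suc j) * B (suc (suc j)) m + L (suc (suc (j ℕ.+ m))) * B (suc j) (suc m)
      + τ ^ suc (suc m) * B j (suc (suc m))
      ≈⟨ +-congʳ (+-cong (*-congˡ binom-outer) (*-cong (L-cong j+2+m) binom-inner)) ⟨
    τ ^ suc (suc j) * binom (j ℕ.+ suc (suc m)) (suc (suc j))
      + L (j ℕ.+ suc (suc m)) * binom (j ℕ.+ suc (suc m)) (suc j) + τ ^ suc (suc m) * B j (suc (suc m)) ∎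
    where
    j+2+m : j ℕ.+ suc (suc m) ≡.≡ suc (suc (j ℕ.+ m))
    j+2+m = ≡.trans (ℕₚ.+-suc j (suc m)) (≡.cong suc (ℕₚ.+-suc j m))
    binom-outer : binom (j ℕ.+ suc (suc m)) (suc (suc j)) ≈ B (suc (suc j)) m
    binom-outer = trans (binom-cong (suc (suc j)) j+2+m) (binom-B (suc (suc j)) m)
    binom-inner : binom (j ℕ.+ suc (suc m)) (suc j) ≈ B (suc j) (suc m)
    binom-inner =
      trans (binom-cong (suc j) (≡.trans j+2+m (≡.sym (≡.cong suc (ℕₚ.+-suc j m))))) (binom-B (suc j) (suc m))

  -- {n+2, j+2} = τ^(j+2) {n, j+2} + L n {n, j+1} + τ^(n-j) {n, j}, multiplied by τ^(j+1) so that
  -- the exponent n - j needs no subtraction and the identity also holds (trivially) for j > n.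
  binom-three-term : ∀ n j → τ ^ suc j * binom (suc (suc n)) (suc (suc j)) ≈
    τ ^ suc j * (τ ^ suc (suc j) * binom n (suc (suc j)) + L n * binom n (suc j)) + τ ^ suc n * binom n j
  binom-three-term n j with ℕₚ.≤-<-connex j n
  ... | inj₂ n<j = begin
    τ ^ suc j * binom (suc (suc n)) (suc (suc j))
      ≈⟨ *-congˡ (binomFrom-vanishes 0 (s≤s (s≤s n<j))) ⟩
    τ ^ suc j * 0#
      ≈⟨ solve 4 (λ p q l r → p :* :0 := p :* (q :* :0 :+ l :* :0) :+ r :* :0) refl _ _ _ _ ⟩
    τ ^ suc j * (τ ^ suc (suc j) * 0# + L n * 0#) + τ ^ suc n * 0#
      ≈⟨ +-cong (*-congˡ (+-cong (*-congˡ (vanishes (ℕₚ.m<n⇒m<1+n (ℕₚ.m<n⇒m<1+n n<j))))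
                                 (*-congˡ (vanishes (ℕₚ.m<n⇒m<1+n n<j)))))
                (*-congˡ (vanishes n<j)) ⟨
    τ ^ suc j * (τ ^ suc (suc j) * binom n (suc (suc j)) + L n * binom n (suc j)) + τ ^ suc n * binom n j ∎
    where
    vanishes : ∀ {j} → n < j → binom n j ≈ 0#
    vanishes = binomFrom-vanishes 0
  ... | inj₁ j≤n with ℕₚ.m≤n⇒∃[o]m+o≡n j≤n
  ... | m , ≡.refl = begin
    τ ^ suc j * binomFrom 2 j (j ℕ.+ m)
      ≈⟨ *-congˡ (trans (binomFrom-B 2 j m) (B-cong (ℕₚ.+-comm j 2))) ⟩
    τ ^ suc j * B (suc (suc j)) m
      ≈⟨ *-congˡ (B-three-term′ j m) ⟩
    τ ^ suc j * (P * binom (j ℕ.+ m) (suc (suc j)) + Q * binom (j ℕ.+ m) (suc j) + τ ^ m * B j m)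
      ≈⟨ solve 7 (λ r p x q y u b → r :* (p :* x :+ q :* y :+ u :* b)
                    := r :* (p :* x :+ q :* y) :+ (r :* u) :* b) refl _ _ _ _ _ _ _ ⟩
    τ ^ suc j * (P * binom (j ℕ.+ m) (suc (suc j)) + Q * binom (j ℕ.+ m) (suc j)) + τ ^ suc j * τ ^ m * B j m
      ≈⟨ +-congˡ (*-cong (^-homo-* τ (suc j) m) (binom-B j m)) ⟨
    τ ^ suc j * (P * binom (j ℕ.+ m) (suc (suc j)) + Q * binom (j ℕ.+ m) (suc j))
      + τ ^ suc (j ℕ.+ m) * binom (j ℕ.+ m) j ∎
    where
    P Q : Carrier
    P = τ ^ suc (suc j)
    Q = L (j ℕ.+ m)

module FibonomialSeries {r ℓ} (R : CommutativeRing r ℓ) (s t : CommutativeRing.Carrier R) where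

  open CommutativeRing R hiding (zero)
  open import Algebra.Properties.Semiring.Exp semiring using (_^_; ^-homo-*; ^-congʳ; ^-congˡ)
  open import Algebra.Properties.CommutativeSemiring.Exp commutativeSemiring using (^-distrib-*)
  open import Algebra.Properties.Ring ring using (-1*x≈-x)
  open import Relation.Binary.Reasoning.Setoid setoid
  open ℤ-Solver R using (solve; _:+_; _:*_; :-_; _:-_; _:=_; :0; :1)
  open FibonacciPolynomials R s t
  open PowerSeries R

  σ : ℕ → Carrier
  σ j = (- 1#) ^ (suc j C 2) * t ^ (j C 2)

  σ-suc : ∀ j → σ (suc j) ≈ - (τ ^ j * σ j)
  σ-suc j = begin
    (- 1#) ^ (suc (suc j) C 2) * t ^ (suc j C 2)
      ≈⟨ *-cong (^-congʳ (- 1#) (C₂-suc (suc j))) (^-congʳ t (C₂-suc j)) ⟩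
    (- 1#) ^ (suc j ℕ.+ suc j C 2) * t ^ (j ℕ.+ j C 2)
      ≈⟨ *-cong (^-homo-* (- 1#) (suc j) _) (^-homo-* t j _) ⟩
    (- 1# * (- 1#) ^ j * (- 1#) ^ (suc j C 2)) * (t ^ j * t ^ (j C 2))
      ≈⟨ solve 4 (λ u a v w → (:- :1 :* u :* a) :* (v :* w) := :- ((u :* v) :* (a :* w))) refl _ _ _ _ ⟩
    - ((- 1#) ^ j * t ^ j * σ j)                 ≈⟨ -‿cong (*-congʳ (^-distrib-* (- 1#) t j)) ⟨
    - ((- 1# * t) ^ j * σ j)                     ≈⟨ -‿cong (*-congʳ (^-congˡ j (-1*x≈-x t))) ⟩
    - (τ ^ j * σ j)                              ∎
    where
    C₂-suc : ∀ n → suc n C 2 ≡.≡ n ℕ.+ n C 2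
    C₂-suc n = ≡.trans (≡.sym (nCk+nC[k+1]≡[n+1]C[k+1] n 1)) (≡.cong (ℕ._+ n C 2) (nC1≡n n))

  denominator : ℕ → Series
  denominator k j = σ j * binom (suc k) j

  -- the quadratic factor (1 - αᵏ⁺² X) (1 - βᵏ⁺² X)
  lucas· : ℕ → Series → Series
  lucas· k = quadratic· (- L (suc k)) (τ ^ suc (suc k))

  denominator-step : ∀ k j → denominator (suc (suc k)) j ≈ lucas· k (dilate τ (denominator k)) j
  denominator-step k zero = solve 3 (λ x l c → x :* :1 := :1 :* (x :* :1) :+ (:- l) :* :0 :+ c :* :0) refl
                                    (σ 0) (L (suc k)) (τ ^ suc (suc k))
  denominator-step k (suc zero) = begin
    σ 1 * B 1 (suc (suc k))                                  ≈⟨ *-congˡ (B-oneˡ (suc (suc k))) ⟩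
    σ 1 * F (suc (suc (suc k)))
      ≈⟨ solve 4 (λ t f₁ f₃ c → (:- :1 :* :1) :* :1 :* f₃
                   := ((:- t) :* :1) :* ((:- :1 :* :1) :* :1 :* f₁)
                      :+ (:- (f₃ :+ t :* f₁)) :* (:1 :* (:1 :* :1 :* :1)) :+ c :* :0)
                refl t (F (suc k)) _ (τ ^ suc (suc k)) ⟩
    τ ^ 1 * (σ 1 * F (suc k)) + (- L (suc k)) * (τ ^ 0 * (σ 0 * 1#)) + τ ^ suc (suc k) * 0#
      ≈⟨ +-congʳ (+-congʳ (*-congˡ (*-congˡ (B-oneˡ k)))) ⟨
    τ ^ 1 * (σ 1 * B 1 k) + (- L (suc k)) * (τ ^ 0 * (σ 0 * 1#)) + τ ^ suc (suc k) * 0# ∎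
  denominator-step k (suc (suc j)) = begin
    σ (suc (suc j)) * X                                      ≈⟨ *-congʳ σ₂ ⟩
    p₁ * (p₀ * σ j) * X
      ≈⟨ solve 4 (λ p₁ p₀ y x → p₁ :* (p₀ :* y) :* x := (p₀ :* y) :* (p₁ :* x)) refl _ _ _ _ ⟩
    p₀ * σ j * (p₁ * X)                                      ≈⟨ *-congˡ (binom-three-term (suc k) j) ⟩
    p₀ * σ j * (p₁ * (p₂ * H₂ + L (suc k) * H₁) + c * H₀)
      ≈⟨ solve 9 (λ p₀ y p₁ p₂ h₂ l h₁ c h₀ →
                    (p₀ :* y) :* (p₁ :* (p₂ :* h₂ :+ l :* h₁) :+ c :* h₀)
                    := p₂ :* ((p₁ :* (p₀ :* y)) :* h₂) :+ (:- l) :* (p₁ :* ((:- (p₀ :* y)) :* h₁))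
                       :+ c :* (p₀ :* (y :* h₀)))
                refl p₀ (σ j) p₁ p₂ H₂ (L (suc k)) H₁ c H₀ ⟩
    p₂ * (p₁ * (p₀ * σ j) * H₂) + (- L (suc k)) * (p₁ * (- (p₀ * σ j) * H₁)) + c * (p₀ * (σ j * H₀))
      ≈⟨ +-congʳ (+-cong (*-congˡ (*-congʳ σ₂)) (*-congˡ (*-congˡ (*-congʳ (σ-suc j))))) ⟨
    p₂ * (σ (suc (suc j)) * H₂) + (- L (suc k)) * (p₁ * (σ (suc j) * H₁)) + c * (p₀ * (σ j * H₀)) ∎
    where
    p₀ p₁ p₂ c X H₀ H₁ H₂ : Carrier
    p₀ = τ ^ j
    p₁ = τ ^ suc j
    p₂ = τ ^ suc (suc j)
    c  = τ ^ suc (suc k)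
    X  = binom (suc (suc (suc k))) (suc (suc j))
    H₀ = binom (suc k) j
    H₁ = binom (suc k) (suc j)
    H₂ = binom (suc k) (suc (suc j))
    σ₂ : σ (suc (suc j)) ≈ p₁ * (p₀ * σ j)
    σ₂ = trans (σ-suc (suc j)) (trans (-‿cong (*-congˡ (σ-suc j))) (solve 2 (λ p y → :- (p :* :- y)
                                                                               := p :* y) refl p₁ (p₀ * σ j)))

  lucas·-B : ∀ k n → lucas· k (B (suc (suc k))) n ≈ dilate τ (B k) n
  lucas·-B k zero = begin
    1# + (- L (suc k)) * 0# + τ ^ suc (suc k) * 0#
      ≈⟨ solve 2 (λ l c → :1 :+ (:- l) :* :0 :+ c :* :0 := :1 :* :1) refl (L (suc k)) _ ⟩
    1# * 1#                                        ≈⟨ *-congˡ (B-zeroʳ k) ⟨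
    τ ^ 0 * B k 0                                  ∎
  lucas·-B k (suc zero) = begin
    B (suc (suc k)) 1 + (- L (suc k)) * 1# + τ ^ suc (suc k) * 0#
      ≈⟨ +-congʳ (+-congʳ (B-oneʳ (suc (suc k)))) ⟩
    F (suc (suc (suc k))) + (- L (suc k)) * 1# + τ ^ suc (suc k) * 0#
      ≈⟨ solve 4 (λ f₃ t f₁ c → f₃ :+ (:- (f₃ :+ t :* f₁)) :* :1 :+ c :* :0 := ((:- t) :* :1) :* f₁)
                refl _ t _ _ ⟩
    τ ^ 1 * F (suc k)                                               ≈⟨ *-congˡ (B-oneʳ k) ⟨
    τ ^ 1 * B k 1                                                   ∎
  lucas·-B k (suc (suc n)) = begin
    B (suc (suc k)) (suc (suc n)) + (- L (suc k)) * B (suc (suc k)) (suc n) + τ ^ suc (suc k) * B (suc (suc k)) n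
      ≈⟨ +-congʳ (+-congʳ (B-recurrence k n)) ⟩
    L (suc k) * B (suc (suc k)) (suc n) - τ ^ suc (suc k) * B (suc (suc k)) n + τ ^ suc (suc n) * B k (suc (suc n))
      + (- L (suc k)) * B (suc (suc k)) (suc n) + τ ^ suc (suc k) * B (suc (suc k)) n
      ≈⟨ solve 6 (λ l x p z q y → l :* x :- p :* z :+ q :* y :+ (:- l) :* x :+ p :* z := q :* y)
                refl _ _ _ _ _ _ ⟩
    τ ^ suc (suc n) * B k (suc (suc n))                             ∎

  denominator-zero : ∀ j → denominator 0 j ≈ quadratic· (- 1#) 0# δ j
  denominator-zero zero          = solve 0 (:1 :* :1 :* :1 := :1 :+ (:- :1) :* :0 :+ :0 :* :0) refl
  denominator-zero (suc zero)    = solve 0 ((:- :1 :* :1) :* :1 :* :1 := :0 :+ (:- :1) :* :1 :+ :0 :* :0) refl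
  denominator-zero (suc (suc j)) =
    trans (zeroʳ (σ (suc (suc j)))) (solve 1 (λ x → :0 := :0 :+ (:- :1) :* :0 :+ :0 :* x) refl (δ j))

  quadratic·-B-zero : ∀ n → quadratic· (- 1#) 0# (B 0) n ≈ δ n
  quadratic·-B-zero zero          = solve 0 (:1 :+ (:- :1) :* :0 :+ :0 :* :0 := :1) refl
  quadratic·-B-zero (suc zero)    = solve 0 (:1 :+ (:- :1) :* :1 :+ :0 :* :0 := :0) refl
  quadratic·-B-zero (suc (suc n)) = solve 0 (:1 :+ (:- :1) :* :1 :+ :0 :* :1 := :0) refl

  denominator-one : ∀ j → denominator 1 j ≈ quadratic· (- s) (- t) δ j
  denominator-one zero = solve 2 (λ s t → :1 :* :1 :* :1 := :1 :+ (:- s) :* :0 :+ (:- t) :* :0) refl s t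
  denominator-one (suc zero) = begin
    σ 1 * B 1 1         ≈⟨ *-congˡ (B-oneˡ 1) ⟩
    σ 1 * F 2           ≈⟨ solve 2 (λ s t → (:- :1 :* :1) :* :1 :* (s :* :1 :+ t :* :0)
                                    := :0 :+ (:- s) :* :1 :+ (:- t) :* :0) refl s t ⟩
    0# + (- s) * 1# + (- t) * 0# ∎
  denominator-one (suc (suc zero)) =
    solve 2 (λ s t → (:- :1 :* (:- :1 :* (:- :1 :* :1))) :* (t :* :1) :* :1
                     := :0 :+ (:- s) :* :0 :+ (:- t) :* :1) refl s t
  denominator-one (suc (suc (suc j))) =
    trans (zeroʳ _) (solve 2 (λ s t → :0 := :0 :+ (:- s) :* :0 :+ (:- t) :* :0) refl s t)

  quadratic·-B-one : ∀ n → quadratic· (- s) (- t) (B 1) n ≈ δ n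
  quadratic·-B-one zero = solve 2 (λ s t → :1 :+ (:- s) :* :0 :+ (:- t) :* :0 := :1) refl s t
  quadratic·-B-one (suc zero) = begin
    B 1 1 + (- s) * 1# + (- t) * 0#          ≈⟨ +-congʳ (+-congʳ (B-oneˡ 1)) ⟩
    F 2 + (- s) * 1# + (- t) * 0#
      ≈⟨ solve 2 (λ s t → s :* :1 :+ t :* :0 :+ (:- s) :* :1 :+ (:- t) :* :0 := :0) refl s t ⟩
    0#                                       ∎
  quadratic·-B-one (suc (suc n)) = begin
    B 1 (suc (suc n)) + (- s) * B 1 (suc n) + (- t) * B 1 n
      ≈⟨ +-cong (+-cong (B-oneˡ (suc (suc n))) (*-congˡ (B-oneˡ (suc n)))) (*-congˡ (B-oneˡ n)) ⟩
    s * F (suc (suc n)) + t * F (suc n) + (- s) * F (suc (suc n)) + (- t) * F (suc n)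
      ≈⟨ solve 4 (λ s t a b → s :* a :+ t :* b :+ (:- s) :* a :+ (:- t) :* b := :0) refl s t _ _ ⟩
    0#                                       ∎

  denominator-inverse : ∀ k n → (denominator k ∗ B k) n ≈ δ n
  denominator-inverse zero          n = quadratic·-inverse (- 1#) 0# denominator-zero quadratic·-B-zero n
  denominator-inverse (suc zero)    n = quadratic·-inverse (- s) (- t) denominator-one quadratic·-B-one n
  denominator-inverse (suc (suc k)) n = begin
    (denominator (suc (suc k)) ∗ B (suc (suc k))) n  ≈⟨ ∗-congˡ (B (suc (suc k))) n (denominator-step k) ⟩
    (lucas· k (dilate τ D) ∗ B (suc (suc k))) n      ≈⟨ quadratic·-∗ _ _ (dilate τ D) (B (suc (suc k))) n ⟩
    (dilate τ D ∗ lucas· k (B (suc (suc k)))) n      ≈⟨ ∗-congʳ (dilate τ D) n (lucas·-B k) ⟩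
    (dilate τ D ∗ dilate τ (B k)) n                  ≈⟨ dilate-∗ τ D (B k) n ⟩
    τ ^ n * (D ∗ B k) n                              ≈⟨ *-congˡ (denominator-inverse k n) ⟩
    τ ^ n * δ n                                      ≈⟨ dilate-δ τ n ⟩
    δ n                                              ∎
    where
    D : Series
    D = denominator k

open Defs

ℤ[t]-ring : CommutativeRing 0ℓ 0ℓ
ℤ[t]-ring = PolynomialRing.polynomialRing +-*-commutativeRing

ℤ[s,t]-ring : CommutativeRing 0ℓ 0ℓ
ℤ[s,t]-ring = PolynomialRing.polynomialRing ℤ[t]-ring

open CommutativeRing ℤ[s,t]-ring
  using (_≈_; refl; sym; trans; reflexive; -‿cong; *-congˡ; *-congʳ; *-cong; +-cong; *-identityʳ; zeroʳ)
open import Algebra.Properties.Ring (CommutativeRing.ring ℤ[s,t]-ring) using (-1*x≈-x)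
open import Algebra.Properties.Semiring.Exp (CommutativeRing.semiring ℤ[s,t]-ring) using (_^_)
open ℤ-Solver ℤ[s,t]-ring using (solve; _:+_; _:*_; _:=_)
open PowerSeries ℤ[s,t]-ring using (∑[≤_]; _∗_; δ)
module 𝔽 = FibonacciPolynomials ℤ[s,t]-ring s t
module 𝕊 = FibonomialSeries ℤ[s,t]-ring s t

≈⇒≈P : ∀ {p q} → p ≈ q → p ≈P q
≈⇒≈P p≈q i j = PolynomialRing._≋_.coeff-≈ (PolynomialRing._≋_.coeff-≈ p≈q i) j

F≡F : ∀ n → F n ≡.≡ 𝔽.F n
F≡F zero          = ≡.refl
F≡F (suc zero)    = ≡.refl
F≡F (suc (suc n)) = ≡.cong₂ (λ a b → s *P a +P t *P b) (F≡F (suc n)) (F≡F n)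

prodF≡F-falling : ∀ n k → prodF n k ≡.≡ 𝔽.F-falling n k
prodF≡F-falling n zero    = ≡.refl
prodF≡F-falling n (suc k) = ≡.cong₂ _*P_ (F≡F (n ∸ k)) (prodF≡F-falling n k)

^P≡^ : ∀ p n → p ^P n ≡.≡ p ^ n
^P≡^ p zero    = ≡.refl
^P≡^ p (suc n) = ≡.cong (p *P_) (^P≡^ p n)

sgn≈-1^ : ∀ m → sgn m ≈ (-P 1P) ^ m
sgn≈-1^ zero    = refl
sgn≈-1^ (suc m) = trans (-‿cong (sgn≈-1^ m)) (sym (-1*x≈-x _))

infix 4 _≐_
record _≐_ (x : Frac) (c : ℤ[s,t]) : Set where
  constructor has-value
  field numerator≈ : proj₁ x ≈ c *P proj₂ x

≐-cong : ∀ {x c c′} → c ≈ c′ → x ≐ c → x ≐ c′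
≐-cong c≈c′ (has-value a≈cb) = has-value (trans a≈cb (*-congʳ c≈c′))

ι-≐ : ∀ p → ι p ≐ p
ι-≐ p = has-value (sym (*-identityʳ p))

+F-≐ : ∀ {x y c d} → x ≐ c → y ≐ d → x +F y ≐ c +P d
+F-≐ {_ , b} {_ , b′} {c} {d} (has-value a≈cb) (has-value a′≈db′) =
  has-value (trans (+-cong (*-congʳ a≈cb) (*-congʳ a′≈db′))
    (solve 4 (λ c b d b′ → c :* b :* b′ :+ d :* b′ :* b := (c :+ d) :* (b :* b′)) refl c b d b′))

*F-≐ : ∀ {x y c d} → x ≐ c → y ≐ d → x *F y ≐ c *P d
*F-≐ {_ , b} {_ , b′} {c} {d} (has-value a≈cb) (has-value a′≈db′) =
  has-value (trans (*-cong a≈cb a′≈db′)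
    (solve 4 (λ c b d b′ → c :* b :* (d :* b′) := (c :* d) :* (b :* b′)) refl c b d b′))

sumTo-≐ : ∀ n {f c} → (∀ j → f j ≐ c j) → sumTo n f ≐ ∑[≤ n ] c
sumTo-≐ zero    f≐c = f≐c zero
sumTo-≐ (suc n) f≐c = +F-≐ (sumTo-≐ n f≐c) (f≐c (suc n))

fibonomial-≐ : ∀ j m → fibonomial (j ℕ.+ m) j ≐ 𝔽.B j m
fibonomial-≐ j m = has-value (begin
  prodF (j ℕ.+ m) j              ≡⟨ prodF≡F-falling (j ℕ.+ m) j ⟩
  𝔽.F-falling (j ℕ.+ m) j        ≈⟨ 𝔽.B-falling j m ⟨
  𝔽.B j m *P 𝔽.F-falling j j     ≡⟨ ≡.cong (𝔽.B j m *P_) (prodF≡F-falling j j) ⟨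
  𝔽.B j m *P prodF j j           ∎)
  where open import Relation.Binary.Reasoning.Setoid (CommutativeRing.setoid ℤ[s,t]-ring)

seriesCoeff-≐ : ∀ k m → seriesCoeff k m ≐ 𝔽.B k m
seriesCoeff-≐ k m = ≡.subst (λ n → fibonomial n k ≐ 𝔽.B k m) (ℕₚ.+-comm k m) (fibonomial-≐ k m)

denomCoeff-≐ : ∀ k j → denomCoeff k j ≐ 𝕊.denominator k j
denomCoeff-≐ k j with j ℕ.≤? suc k
... | yes j≤1+k = ≐-cong (*-congʳ (*-cong (sgn≈-1^ (suc j C 2)) (reflexive (^P≡^ t (j C 2)))))
                    (*F-≐ (ι-≐ (sgn (suc j C 2) *P t ^P (j C 2))) (fibonomial-≐′ j≤1+k))
  where
  fibonomial-≐′ : ∀ {n} → j ℕ.≤ n → fibonomial n j ≐ 𝔽.binom n j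
  fibonomial-≐′ j≤n with ℕₚ.m≤n⇒∃[o]m+o≡n j≤n
  ... | m , ≡.refl = ≐-cong (sym (𝔽.binom-B j m)) (fibonomial-≐ j m)
... | no j≰1+k = ≐-cong 0≈σ·binom (ι-≐ 0P)
  where
  0≈σ·binom : 0P ≈ 𝕊.σ j *P 𝔽.binom (suc k) j
  0≈σ·binom = trans (sym (zeroʳ (𝕊.σ j)))
                     (*-congˡ {𝕊.σ j} (sym (𝔽.binomFrom-vanishes 0 {suc k} {j} (ℕₚ.≰⇒> j≰1+k))))

cauchy-≐ : ∀ k n → cauchy (denomCoeff k) (seriesCoeff k) n ≐ (𝕊.denominator k ∗ 𝔽.B k) n
cauchy-≐ k n = sumTo-≐ n λ j → *F-≐ (denomCoeff-≐ k j) (seriesCoeff-≐ k (n ∸ j))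

oneSeries≡ιδ : ∀ n → oneSeries n ≡.≡ ι (δ n)
oneSeries≡ιδ zero    = ≡.refl
oneSeries≡ιδ (suc n) = ≡.refl

≐⇒≃ι : ∀ {x c} → x ≐ c → x ≃ ι c
≐⇒≃ι {a , b} (has-value a≈cb) = ≈⇒≈P (trans (*-identityʳ a) a≈cb)

mainTheorem12 : (k : ℕ) → (n : ℕ) →
    cauchy (denomCoeff k) (seriesCoeff k) n ≃ oneSeries n
mainTheorem12 k n = ≡.subst (cauchy (denomCoeff k) (seriesCoeff k) n ≃_) (≡.sym (oneSeries≡ιδ n))
  (≐⇒≃ι (≐-cong (𝕊.denominator-inverse k n) (cauchy-≐ k n)))
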